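{- For all terms $P,Q$ of $\lambda_c^u$, if $P\Rrightarrow Q$ then $Q\Rrightarrow P^*$ (triangle property).
   Context: Syntax of $\lambda_c^u$: values $V ::= x\mid \lambda x.M$, computations $M ::= \mathit{unit}\,V\mid M\star V$; terms are values or computations, up to renaming of bound variables; $M[V/x]$ is capture-avoiding substitution. The relation $\Rrightarrow$ on terms is inductively defined by: (i) $x\Rrightarrow x$; (ii) $M\Rrightarrow N\Rightarrow\lambda x.M\Rrightarrow\lambda x.N$; (iii) $V\Rrightarrow V'\Rightarrow\mathit{unit}\,V\Rrightarrow\mathit{unit}\,V'$; (iv) $M\Rrightarrow M'$ and $V\Rrightarrow V'$ $\Rightarrow M\star V\Rrightarrow M'\star V'$; (v) $M\Rrightarrow M'$ and $V\Rrightarrow V'$ $\Rightarrow\mathit{unit}\,V\star\lambda x.M\Rrightarrow M'[V'/x]$; (vi) $M\Rrightarrow M'\Rightarrow M\star\lambda x.\mathit{unit}\,x\Rrightarrow M'$. The term $P^*$ is defined by: $x^*=x$; $(\lambda x.M)^*=\lambda x.M^*$; $(\mathit{unit}\,V)^*=\mathit{unit}\,V^*$; $(\mathit{unit}\,V\star\lambda x.M)^*=M^*[V^*/x]$; $(M\star\lambda x.\mathit{unit}\,x)^*=M^*$ if $M$ is not of the form $\mathit{unit}\,V$; $(M\star V)^*=M^*\star V^*$ if $M$ is not of the form $\mathit{unit}\,W$ and $V$ is not $\lambda x.\mathit{unit}\,x$. -}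

module Defs where

open import Data.Nat using (ℕ; zero; suc)
open import Data.Fin using (Fin; zero; suc)

-- Syntax of λ_c^u, well-scoped de Bruijn representation
-- (terms up to renaming of bound variables = alpha-equivalence).
-- A term of sort `val` is a value V ::= x | λx.M,
-- a term of sort `comp` is a computation M ::= unit V | M ⋆ V.

data Sort : Set where
  val comp : Sort

data Tm : Sort → ℕ → Set where
  var  : ∀ {n} → Fin n → Tm val n
  lam  : ∀ {n} → Tm comp (suc n) → Tm val n
  unit : ∀ {n} → Tm val n → Tm comp n
  _⋆_  : ∀ {n} → Tm comp n → Tm val n → Tm comp n

infixl 5 _⋆_

Ren : ℕ → ℕ → Set
Ren m n = Fin m → Fin n

extR : ∀ {m n} → Ren m n → Ren (suc m) (suc n)
extR ρ zero    = zero
extR ρ (suc i) = suc (ρ i)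

rename : ∀ {s m n} → Ren m n → Tm s m → Tm s n
rename ρ (var i)  = var (ρ i)
rename ρ (lam M)  = lam (rename (extR ρ) M)
rename ρ (unit V) = unit (rename ρ V)
rename ρ (M ⋆ V)  = rename ρ M ⋆ rename ρ V

Sub : ℕ → ℕ → Set
Sub m n = Fin m → Tm val n

extS : ∀ {m n} → Sub m n → Sub (suc m) (suc n)
extS σ zero    = var zero
extS σ (suc i) = rename suc (σ i)

subst : ∀ {s m n} → Sub m n → Tm s m → Tm s n
subst σ (var i)  = σ i
subst σ (lam M)  = lam (subst (extS σ) M)
subst σ (unit V) = unit (subst σ V)
subst σ (M ⋆ V)  = subst σ M ⋆ subst σ V

-- Single substitution M[V/x], x being the innermost bound variable (index 0)
sub1 : ∀ {n} → Tm val n → Sub (suc n) n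
sub1 V zero    = V
sub1 V (suc i) = var i

_[_] : ∀ {s n} → Tm s (suc n) → Tm val n → Tm s n
M [ V ] = subst (sub1 V) M

infix 4 _⇛_
data _⇛_ : ∀ {s n} → Tm s n → Tm s n → Set where
  ⇛var  : ∀ {n} {x : Fin n} → var x ⇛ var x
  ⇛lam  : ∀ {n} {M N : Tm comp (suc n)} → M ⇛ N → lam M ⇛ lam N
  ⇛unit : ∀ {n} {V V′ : Tm val n} → V ⇛ V′ → unit V ⇛ unit V′
  ⇛⋆    : ∀ {n} {M M′ : Tm comp n} {V V′ : Tm val n} →
          M ⇛ M′ → V ⇛ V′ → M ⋆ V ⇛ M′ ⋆ V′
  ⇛β    : ∀ {n} {M M′ : Tm comp (suc n)} {V V′ : Tm val n} →
          M ⇛ M′ → V ⇛ V′ → unit V ⋆ lam M ⇛ M′ [ V′ ]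
  ⇛η    : ∀ {n} {M M′ : Tm comp n} →
          M ⇛ M′ → M ⋆ lam (unit (var zero)) ⇛ M′

-- The complete development P*
-- (clauses are tried in order: the second ⋆-clause applies only when M is
--  not of the form unit V; the last only when neither earlier clause applies)
_* : ∀ {s n} → Tm s n → Tm s n
var x *                      = var x
lam M *                      = lam (M *)
unit V *                     = unit (V *)
(unit V ⋆ lam M) *           = (M *) [ V * ]
(M ⋆ lam (unit (var zero))) * = M *
(M ⋆ V) *                    = (M *) ⋆ (V *)

-- Takahashi's method, by induction on the derivation of P ⇛ Q.  The congruence
-- cases follow from the induction hypotheses, with the rule for P ⋆ V split so
-- that the defining clause of (P ⋆ V)* is determined.  A β-step unit V ⋆ λx.M ⇛
-- M′[V′/x] is matched by P* = M*[V*/x] because ⇛ is stable under parallel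
-- substitution (M ⇛ N and V ⇛ W give M[V/x] ⇛ N[W/x]); an η-step needs nothing
-- beyond the induction hypothesis.
module Submission where

open import Defs
open import Data.Nat as ℕ using ()
open import Data.Fin using (zero; suc)
open import Function using (_∘_)
open import Relation.Binary.PropositionalEquality
  using (_≡_; refl; sym; trans; cong; cong₂; module ≡-Reasoning)

open ≡-Reasoning

rename-cong : ∀ {s m n} {ρ ρ′ : Ren m n} →
              (∀ i → ρ i ≡ ρ′ i) → (M : Tm s m) → rename ρ M ≡ rename ρ′ M
rename-cong eq (var i)  = cong var (eq i)
rename-cong eq (lam M)  = cong lam (rename-cong extR-cong M)
  where
  extR-cong : ∀ i → extR _ i ≡ extR _ i
  extR-cong zero    = refl
  extR-cong (suc i) = cong suc (eq i)
rename-cong eq (unit V) = cong unit (rename-cong eq V)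
rename-cong eq (M ⋆ V)  = cong₂ _⋆_ (rename-cong eq M) (rename-cong eq V)

subst-cong : ∀ {s m n} {σ σ′ : Sub m n} →
             (∀ i → σ i ≡ σ′ i) → (M : Tm s m) → subst σ M ≡ subst σ′ M
subst-cong eq (var i)  = eq i
subst-cong eq (lam M)  = cong lam (subst-cong extS-cong M)
  where
  extS-cong : ∀ i → extS _ i ≡ extS _ i
  extS-cong zero    = refl
  extS-cong (suc i) = cong (rename suc) (eq i)
subst-cong eq (unit V) = cong unit (subst-cong eq V)
subst-cong eq (M ⋆ V)  = cong₂ _⋆_ (subst-cong eq M) (subst-cong eq V)

rename-rename : ∀ {s k m n} (ρ : Ren m n) (ρ′ : Ren k m) (M : Tm s k) →
                rename ρ (rename ρ′ M) ≡ rename (ρ ∘ ρ′) M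
rename-rename ρ ρ′ (var i)  = refl
rename-rename ρ ρ′ (lam M)  =
  cong lam (trans (rename-rename (extR ρ) (extR ρ′) M) (rename-cong extR-∘ M))
  where
  extR-∘ : ∀ i → extR ρ (extR ρ′ i) ≡ extR (ρ ∘ ρ′) i
  extR-∘ zero    = refl
  extR-∘ (suc i) = refl
rename-rename ρ ρ′ (unit V) = cong unit (rename-rename ρ ρ′ V)
rename-rename ρ ρ′ (M ⋆ V)  = cong₂ _⋆_ (rename-rename ρ ρ′ M) (rename-rename ρ ρ′ V)

rename-subst : ∀ {s k m n} (ρ : Ren m n) (σ : Sub k m) (M : Tm s k) →
               rename ρ (subst σ M) ≡ subst (rename ρ ∘ σ) M
rename-subst ρ σ (var i)  = refl
rename-subst ρ σ (lam M)  =
  cong lam (trans (rename-subst (extR ρ) (extS σ) M) (subst-cong extR-extS M))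
  where
  extR-extS : ∀ i → rename (extR ρ) (extS σ i) ≡ extS (rename ρ ∘ σ) i
  extR-extS zero    = refl
  extR-extS (suc i) = trans (rename-rename (extR ρ) suc (σ i))
                            (sym (rename-rename suc ρ (σ i)))
rename-subst ρ σ (unit V) = cong unit (rename-subst ρ σ V)
rename-subst ρ σ (M ⋆ V)  = cong₂ _⋆_ (rename-subst ρ σ M) (rename-subst ρ σ V)

subst-rename : ∀ {s k m n} (σ : Sub m n) (ρ : Ren k m) (M : Tm s k) →
               subst σ (rename ρ M) ≡ subst (σ ∘ ρ) M
subst-rename σ ρ (var i)  = refl
subst-rename σ ρ (lam M)  =
  cong lam (trans (subst-rename (extS σ) (extR ρ) M) (subst-cong extS-extR M))
  where
  extS-extR : ∀ i → extS σ (extR ρ i) ≡ extS (σ ∘ ρ) i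
  extS-extR zero    = refl
  extS-extR (suc i) = refl
subst-rename σ ρ (unit V) = cong unit (subst-rename σ ρ V)
subst-rename σ ρ (M ⋆ V)  = cong₂ _⋆_ (subst-rename σ ρ M) (subst-rename σ ρ V)

subst-subst : ∀ {s k m n} (σ : Sub m n) (τ : Sub k m) (M : Tm s k) →
              subst σ (subst τ M) ≡ subst (subst σ ∘ τ) M
subst-subst σ τ (var i)  = refl
subst-subst σ τ (lam M)  =
  cong lam (trans (subst-subst (extS σ) (extS τ) M) (subst-cong extS-extS M))
  where
  extS-extS : ∀ i → subst (extS σ) (extS τ i) ≡ extS (subst σ ∘ τ) i
  extS-extS zero    = refl
  extS-extS (suc i) = trans (subst-rename (extS σ) suc (τ i))
                            (sym (rename-subst suc σ (τ i)))
subst-subst σ τ (unit V) = cong unit (subst-subst σ τ V)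
subst-subst σ τ (M ⋆ V)  = cong₂ _⋆_ (subst-subst σ τ M) (subst-subst σ τ V)

subst-var : ∀ {s n} (M : Tm s n) → subst var M ≡ M
subst-var (var i)  = refl
subst-var (lam M)  = cong lam (trans (subst-cong extS-var M) (subst-var M))
  where
  extS-var : ∀ i → extS var i ≡ var i
  extS-var zero    = refl
  extS-var (suc i) = refl
subst-var (unit V) = cong unit (subst-var V)
subst-var (M ⋆ V)  = cong₂ _⋆_ (subst-var M) (subst-var V)

rename-[] : ∀ {m n} (ρ : Ren m n) (M : Tm comp (ℕ.suc m)) (V : Tm val m) →
            rename ρ (M [ V ]) ≡ rename (extR ρ) M [ rename ρ V ]
rename-[] ρ M V = begin
  rename ρ (M [ V ])                       ≡⟨ rename-subst ρ (sub1 V) M ⟩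
  subst (rename ρ ∘ sub1 V) M              ≡⟨ subst-cong sub1-extR M ⟩
  subst (sub1 (rename ρ V) ∘ extR ρ) M     ≡⟨ subst-rename (sub1 (rename ρ V)) (extR ρ) M ⟨
  rename (extR ρ) M [ rename ρ V ]         ∎
  where
  sub1-extR : ∀ i → rename ρ (sub1 V i) ≡ sub1 (rename ρ V) (extR ρ i)
  sub1-extR zero    = refl
  sub1-extR (suc i) = refl

subst-[] : ∀ {m n} (σ : Sub m n) (M : Tm comp (ℕ.suc m)) (V : Tm val m) →
           subst σ (M [ V ]) ≡ subst (extS σ) M [ subst σ V ]
subst-[] σ M V = begin
  subst σ (M [ V ])                        ≡⟨ subst-subst σ (sub1 V) M ⟩
  subst (subst σ ∘ sub1 V) M               ≡⟨ subst-cong sub1-extS M ⟩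
  subst (subst (sub1 (subst σ V)) ∘ extS σ) M
                                           ≡⟨ subst-subst (sub1 (subst σ V)) (extS σ) M ⟨
  subst (extS σ) M [ subst σ V ]           ∎
  where
  sub1-extS : ∀ i → subst σ (sub1 V i) ≡ subst (sub1 (subst σ V)) (extS σ i)
  sub1-extS zero    = refl
  sub1-extS (suc i) = sym (trans (subst-rename (sub1 (subst σ V)) suc (σ i))
                                 (subst-var (σ i)))

⇛-rename : ∀ {s m n} (ρ : Ren m n) {M N : Tm s m} → M ⇛ N → rename ρ M ⇛ rename ρ N
⇛-rename ρ ⇛var       = ⇛var
⇛-rename ρ (⇛lam d)   = ⇛lam (⇛-rename (extR ρ) d)
⇛-rename ρ (⇛unit d)  = ⇛unit (⇛-rename ρ d)
⇛-rename ρ (⇛⋆ d e)   = ⇛⋆ (⇛-rename ρ d) (⇛-rename ρ e)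
⇛-rename ρ (⇛β {M′ = M′} {V′ = V′} d e) rewrite rename-[] ρ M′ V′ =
  ⇛β (⇛-rename (extR ρ) d) (⇛-rename ρ e)
⇛-rename ρ (⇛η d)     = ⇛η (⇛-rename ρ d)

⇛-extS : ∀ {m n} {σ τ : Sub m n} → (∀ i → σ i ⇛ τ i) → ∀ i → extS σ i ⇛ extS τ i
⇛-extS σ⇛τ zero    = ⇛var
⇛-extS σ⇛τ (suc i) = ⇛-rename suc (σ⇛τ i)

⇛-subst : ∀ {s m n} {σ τ : Sub m n} → (∀ i → σ i ⇛ τ i) →
          {M N : Tm s m} → M ⇛ N → subst σ M ⇛ subst τ N
⇛-subst σ⇛τ (⇛var {x = x}) = σ⇛τ x
⇛-subst σ⇛τ (⇛lam d)       = ⇛lam (⇛-subst (⇛-extS σ⇛τ) d)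
⇛-subst σ⇛τ (⇛unit d)      = ⇛unit (⇛-subst σ⇛τ d)
⇛-subst σ⇛τ (⇛⋆ d e)       = ⇛⋆ (⇛-subst σ⇛τ d) (⇛-subst σ⇛τ e)
⇛-subst {τ = τ} σ⇛τ (⇛β {M′ = M′} {V′ = V′} d e) rewrite subst-[] τ M′ V′ =
  ⇛β (⇛-subst (⇛-extS σ⇛τ) d) (⇛-subst σ⇛τ e)
⇛-subst σ⇛τ (⇛η d)         = ⇛η (⇛-subst σ⇛τ d)

⇛-[] : ∀ {n} {M N : Tm comp (ℕ.suc n)} {V W : Tm val n} →
       M ⇛ N → V ⇛ W → M [ V ] ⇛ N [ W ]
⇛-[] M⇛N V⇛W = ⇛-subst sub1-⇛ M⇛N
  where
  sub1-⇛ : ∀ i → sub1 _ i ⇛ sub1 _ i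
  sub1-⇛ zero    = V⇛W
  sub1-⇛ (suc i) = ⇛var

mainTheorem19 : ∀ {s n} {P Q : Tm s n} → P ⇛ Q → Q ⇛ P *
mainTheorem19 ⇛var      = ⇛var
mainTheorem19 (⇛lam d)  = ⇛lam (mainTheorem19 d)
mainTheorem19 (⇛unit d) = ⇛unit (mainTheorem19 d)
mainTheorem19 (⇛⋆ {M = unit W} {V = lam K} (⇛unit d) (⇛lam e)) =
  ⇛β (mainTheorem19 e) (mainTheorem19 d)
mainTheorem19 (⇛⋆ {M = unit W}  {V = var x} d e) = ⇛⋆ (mainTheorem19 d) (mainTheorem19 e)
mainTheorem19 (⇛⋆ {M = M ⋆ W}   {V = var x} d e) = ⇛⋆ (mainTheorem19 d) (mainTheorem19 e)
mainTheorem19 (⇛⋆ {M = M ⋆ W} {V = lam (unit (var zero))} d (⇛lam (⇛unit ⇛var))) =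
  ⇛η (mainTheorem19 d)
mainTheorem19 (⇛⋆ {M = M ⋆ W} {V = lam (unit (var (suc i)))} d e) =
  ⇛⋆ (mainTheorem19 d) (mainTheorem19 e)
mainTheorem19 (⇛⋆ {M = M ⋆ W} {V = lam (unit (lam K))} d e) =
  ⇛⋆ (mainTheorem19 d) (mainTheorem19 e)
mainTheorem19 (⇛⋆ {M = M ⋆ W} {V = lam (K ⋆ L)} d e) =
  ⇛⋆ (mainTheorem19 d) (mainTheorem19 e)
mainTheorem19 (⇛β d e) = ⇛-[] (mainTheorem19 d) (mainTheorem19 e)
-- unit V ⋆ λx.unit x is also a β-redex, and _* contracts it as one.
mainTheorem19 (⇛η {M = unit V} (⇛unit d)) = ⇛unit (mainTheorem19 d)
mainTheorem19 (⇛η {M = M ⋆ W} d) = mainTheorem19 d
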